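{- Let $\alpha,\beta,\gamma\in\mathbb C$ and $\epsilon\in\{1,-1\}$. Then $\lambda$ is an eigenvalue of $\mathbb L_1=\begin{pmatrix}0&\alpha&\beta\\ \gamma&0&0\\ 0&\beta&\epsilon\alpha\end{pmatrix}$ if and only if $\epsilon\lambda$ is an eigenvalue of $\mathbb L_2=\begin{pmatrix}0&\alpha&\beta\\ \gamma&0&0\\ 0&\epsilon\beta&\alpha\end{pmatrix}$. -}

module Defs where

open import Level using (Level; _⊔_)
open import Algebra.Bundles using (CommutativeRing)
open import Data.Fin using (Fin; zero; suc)
open import Data.Product using (Σ; ∃; _×_)
open import Relation.Nullary using (¬_)

record IsField {c ℓ : Level} (K : CommutativeRing c ℓ) : Set (c ⊔ ℓ) where
  open CommutativeRing K hiding (zero)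
  field
    0≉1     : ¬ (0# ≈ 1#)
    inverse : ∀ x → ¬ (x ≈ 0#) → ∃ λ y → x * y ≈ 1#

module LinearAlgebra {c ℓ : Level} (K : CommutativeRing c ℓ) where
  open CommutativeRing K hiding (zero)

  Mat3 : Set c
  Mat3 = Fin 3 → Fin 3 → Carrier

  Vec3 : Set c
  Vec3 = Fin 3 → Carrier

  _·_ : Mat3 → Vec3 → Vec3
  (M · v) i = (M i zero * v zero + M i (suc zero) * v (suc zero))
              + M i (suc (suc zero)) * v (suc (suc zero))

  NonZeroVec : Vec3 → Set ℓ
  NonZeroVec v = ¬ (∀ i → v i ≈ 0#)

  IsEigenvalue : Mat3 → Carrier → Set (c ⊔ ℓ)
  IsEigenvalue M λ′ = Σ Vec3 λ v → NonZeroVec v × (∀ i → (M · v) i ≈ λ′ * v i)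

  mat : Carrier → Carrier → Carrier →
        Carrier → Carrier → Carrier →
        Carrier → Carrier → Carrier → Mat3
  mat a b c′ d e f g h k zero zero = a
  mat a b c′ d e f g h k zero (suc zero) = b
  mat a b c′ d e f g h k zero (suc (suc zero)) = c′
  mat a b c′ d e f g h k (suc zero) zero = d
  mat a b c′ d e f g h k (suc zero) (suc zero) = e
  mat a b c′ d e f g h k (suc zero) (suc (suc zero)) = f
  mat a b c′ d e f g h k (suc (suc zero)) zero = g
  mat a b c′ d e f g h k (suc (suc zero)) (suc zero) = h
  mat a b c′ d e f g h k (suc (suc zero)) (suc (suc zero)) = k

  L₁ : Carrier → Carrier → Carrier → Carrier → Mat3
  L₁ α β γ ε = mat 0# α β  γ 0# 0#  0# β (ε * α)

  L₂ : Carrier → Carrier → Carrier → Carrier → Mat3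
  L₂ α β γ ε = mat 0# α β  γ 0# 0#  0# (ε * β) α

{-# OPTIONS --safe #-}
module Submission where

-- With D = diag(1, ε, ε) and ε² = 1 we have 𝕃₂ = ε D 𝕃₁ D. Since ε and D are
-- involutions, v ↦ D v carries λ-eigenvectors of 𝕃₁ to ελ-eigenvectors of 𝕃₂
-- and back. Nothing beyond commutativity is used.

open import Defs
open import Level using (Level)
open import Algebra.Bundles using (CommutativeRing)
open import Data.Sum using (_⊎_; inj₁; inj₂)
open import Function.Bundles using (_⇔_; mk⇔)
open import Data.Fin using (zero; suc)
open import Data.Product using (_,_)

module DiagonalSimilarity {c ℓ : Level} (K : CommutativeRing c ℓ) where
  open CommutativeRing K hiding (zero)
  open LinearAlgebra K
  open import Relation.Binary.Reasoning.Setoid setoid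
  open import Algebra.Solver.Ring.NaturalCoefficients.Default commutativeSemiring
  open import Algebra.Properties.Ring ring using (-1*x≈-x; -‿involutive)

  sign-square : ∀ {ε} → ε ≈ 1# ⊎ ε ≈ - 1# → ε * ε ≈ 1#
  sign-square (inj₁ ε≈1)  = trans (*-cong ε≈1 ε≈1) (*-identityˡ 1#)
  sign-square (inj₂ ε≈-1) =
    trans (*-cong ε≈-1 ε≈-1) (trans (-1*x≈-x (- 1#)) (-‿involutive 1#))

  square-cancel : ∀ {s} → s * s ≈ 1# → ∀ x → s * (s * x) ≈ x
  square-cancel {s} s²≈1 x = begin
    s * (s * x)  ≈⟨ sym (*-assoc s s x) ⟩
    (s * s) * x  ≈⟨ *-congʳ s²≈1 ⟩
    1# * x       ≈⟨ *-identityˡ x ⟩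
    x            ∎

  scale : Vec3 → Vec3 → Vec3
  scale d v i = d i * v i

  -- N = s · D M D, where D is the diagonal matrix with diagonal d
  DiagonallySimilar : Carrier → Vec3 → Mat3 → Mat3 → Set ℓ
  DiagonallySimilar s d N M = ∀ i j → N i j ≈ s * (d i * (M i j * d j))

  Involutive : Vec3 → Set ℓ
  Involutive d = ∀ i → d i * d i ≈ 1#

  diagonallySimilar-sym : ∀ {s d N M} → s * s ≈ 1# → Involutive d →
    DiagonallySimilar s d N M → DiagonallySimilar s d M N
  diagonallySimilar-sym {s} {d} {N} {M} s²≈1 d²≈1 N≈sDMD i j = begin
    M i j
      ≈⟨ sym (square-cancel s²≈1 _) ⟩
    s * (s * M i j)
      ≈⟨ *-congˡ (*-congˡ (sym (square-cancel (d²≈1 i) _))) ⟩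
    s * (s * (d i * (d i * M i j)))
      ≈⟨ *-congˡ (*-congˡ (*-congˡ (*-congˡ (sym (square-cancel (d²≈1 j) _))))) ⟩
    s * (s * (d i * (d i * (d j * (d j * M i j)))))
      ≈⟨ solve 5 (λ s di dj m x → s :* (s :* (di :* (di :* (dj :* (dj :* m)))))
                                  := s :* (di :* ((s :* (di :* (m :* dj))) :* dj)))
               refl s (d i) (d j) (M i j) (N i j) ⟩
    s * (d i * ((s * (d i * (M i j * d j))) * d j))
      ≈⟨ *-congˡ (*-congˡ (*-congʳ (sym (N≈sDMD i j)))) ⟩
    s * (d i * (N i j * d j)) ∎

  ·-scale : ∀ {s d N M} → Involutive d → DiagonallySimilar s d N M →
    ∀ v i → (N · scale d v) i ≈ s * (d i * (M · v) i)
  ·-scale {s} {d} {N} {M} d²≈1 N≈sDMD v i =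
    trans (+-cong (+-cong (entry zero) (entry (suc zero))) (entry (suc (suc zero))))
          (solve 5 (λ s di a b e → (s :* (di :* a) :+ s :* (di :* b)) :+ s :* (di :* e)
                                   := s :* (di :* ((a :+ b) :+ e)))
                 refl s (d i) _ _ _)
    where
    entry : ∀ j → N i j * (d j * v j) ≈ s * (d i * (M i j * v j))
    entry j = begin
      N i j * (d j * v j)
        ≈⟨ *-congʳ (N≈sDMD i j) ⟩
      (s * (d i * (M i j * d j))) * (d j * v j)
        ≈⟨ solve 5 (λ s di dj m x → (s :* (di :* (m :* dj))) :* (dj :* x)
                                    := s :* (di :* (m :* (dj :* (dj :* x)))))
                 refl s (d i) (d j) (M i j) (v j) ⟩
      s * (d i * (M i j * (d j * (d j * v j))))
        ≈⟨ *-congˡ (*-congˡ (*-congˡ (square-cancel (d²≈1 j) (v j)))) ⟩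
      s * (d i * (M i j * v j)) ∎

  scale-nonZero : ∀ {d} → Involutive d → ∀ {v} → NonZeroVec v → NonZeroVec (scale d v)
  scale-nonZero {d} d²≈1 {v} v≉0 dv≈0 = v≉0 λ i → begin
    v i               ≈⟨ sym (square-cancel (d²≈1 i) (v i)) ⟩
    d i * (d i * v i) ≈⟨ *-congˡ (dv≈0 i) ⟩
    d i * 0#          ≈⟨ zeroʳ (d i) ⟩
    0#                ∎

  isEigenvalue-resp : ∀ {M μ ν} → μ ≈ ν → IsEigenvalue M μ → IsEigenvalue M ν
  isEigenvalue-resp μ≈ν (v , v≉0 , Mv≈μv) = v , v≉0 , λ i → trans (Mv≈μv i) (*-congʳ μ≈ν)

  isEigenvalue-scale : ∀ {s d N M μ} → Involutive d → DiagonallySimilar s d N M →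
    IsEigenvalue M μ → IsEigenvalue N (s * μ)
  isEigenvalue-scale {s} {d} {N} {M} {μ} d²≈1 N≈sDMD (v , v≉0 , Mv≈μv) =
    scale d v , scale-nonZero d²≈1 v≉0 , λ i → begin
      (N · scale d v) i       ≈⟨ ·-scale d²≈1 N≈sDMD v i ⟩
      s * (d i * (M · v) i)   ≈⟨ *-congˡ (*-congˡ (Mv≈μv i)) ⟩
      s * (d i * (μ * v i))   ≈⟨ solve 4 (λ s di m x → s :* (di :* (m :* x))
                                                    := (s :* m) :* (di :* x))
                                        refl s (d i) μ (v i) ⟩
      (s * μ) * (d i * v i)   ∎

  isEigenvalue-diagonallySimilar : ∀ {s d N M} → s * s ≈ 1# → Involutive d →
    DiagonallySimilar s d N M → ∀ μ → IsEigenvalue M μ ⇔ IsEigenvalue N (s * μ)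
  isEigenvalue-diagonallySimilar {N = N} {M = M} s²≈1 d²≈1 N≈sDMD μ =
    mk⇔ (isEigenvalue-scale d²≈1 N≈sDMD)
        (λ Nsμ → isEigenvalue-resp {M = M} (square-cancel s²≈1 μ)
                   (isEigenvalue-scale {M = N} d²≈1
                     (diagonallySimilar-sym {M = M} s²≈1 d²≈1 N≈sDMD) Nsμ))

  diag1εε : Carrier → Vec3
  diag1εε ε zero             = 1#
  diag1εε ε (suc zero)       = ε
  diag1εε ε (suc (suc zero)) = ε

  diag1εε-involutive : ∀ {ε} → ε * ε ≈ 1# → Involutive (diag1εε ε)
  diag1εε-involutive ε²≈1 zero             = *-identityˡ 1#
  diag1εε-involutive ε²≈1 (suc zero)       = ε²≈1
  diag1εε-involutive ε²≈1 (suc (suc zero)) = ε²≈1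

  L₂-diagonallySimilar-L₁ : ∀ {ε} → ε * ε ≈ 1# → ∀ α β γ →
    DiagonallySimilar ε (diag1εε ε) (L₂ α β γ ε) (L₁ α β γ ε)
  L₂-diagonallySimilar-L₁ {ε} ε²≈1 α β γ = entries
    where
    from-ε² : ∀ x y → ε * (ε * x) ≈ y → x ≈ y
    from-ε² x y p = trans (sym (square-cancel ε²≈1 x)) p

    vanish : ∀ a b → 0# ≈ ε * (a * (0# * b))
    vanish a b = solve 3 (λ e a b → con 0 := e :* (a :* (con 0 :* b))) refl ε a b

    entries : DiagonallySimilar ε (diag1εε ε) (L₂ α β γ ε) (L₁ α β γ ε)
    entries zero             zero             = vanish _ _
    entries zero             (suc zero)       =
      from-ε² α _ (solve 2 (λ e a → e :* (e :* a) := e :* (con 1 :* (a :* e))) refl ε α)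
    entries zero             (suc (suc zero)) =
      from-ε² β _ (solve 2 (λ e b → e :* (e :* b) := e :* (con 1 :* (b :* e))) refl ε β)
    entries (suc zero)       zero             =
      from-ε² γ _ (solve 2 (λ e g → e :* (e :* g) := e :* (e :* (g :* con 1))) refl ε γ)
    entries (suc zero)       (suc zero)       = vanish _ _
    entries (suc zero)       (suc (suc zero)) = vanish _ _
    entries (suc (suc zero)) zero             = vanish _ _
    entries (suc (suc zero)) (suc zero)       =
      from-ε² (ε * β) _ (solve 2 (λ e b → e :* (e :* (e :* b)) := e :* (e :* (b :* e))) refl ε β)
    entries (suc (suc zero)) (suc (suc zero)) = begin
      α                       ≈⟨ sym (square-cancel ε²≈1 α) ⟩
      ε * (ε * α)             ≈⟨ *-congˡ (*-congˡ (sym (square-cancel ε²≈1 α))) ⟩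
      ε * (ε * (ε * (ε * α))) ≈⟨ solve 2 (λ e a → e :* (e :* (e :* (e :* a)))
                                                := e :* (e :* ((e :* a) :* e)))
                                       refl ε α ⟩
      ε * (ε * ((ε * α) * ε)) ∎

mainTheorem2 : {c ℓ : Level} (K : CommutativeRing c ℓ) → IsField K →
    let open CommutativeRing K
        open LinearAlgebra K
    in (α β γ ε : Carrier) → (ε ≈ 1# ⊎ ε ≈ - 1#) → (λ′ : Carrier) →
       IsEigenvalue (L₁ α β γ ε) λ′ ⇔ IsEigenvalue (L₂ α β γ ε) (ε * λ′)
mainTheorem2 K _ α β γ ε ε≈±1 =
  isEigenvalue-diagonallySimilar ε²≈1 (diag1εε-involutive ε²≈1)
    (L₂-diagonallySimilar-L₁ ε²≈1 α β γ)
  where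
  open CommutativeRing K using (_≈_; _*_; 1#)
  open DiagonalSimilarity K
  ε²≈1 : ε * ε ≈ 1#
  ε²≈1 = sign-square ε≈±1
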